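{- Let $w$ be a binary word with $|w|>7$ and $l(w)=5$. Then all elements of $\mathtt{BR}(w)$ are rich if and only if $w$ is $a^{n_1}ba^{n_3}ba^{n_5}$, or one of $ab^{n_2}ab^{n_4}a^2$, $a^2b^{n_2}ab^{n_4}a$, $ab^{n_2}a^2b^{n_4}a$ with $n_2+n_4=4$, where all $n_i\ge 1$ are integers.
   Context: A binary word is a word over a two-letter alphabet $\{a,b\}$ in which both letters occur; $a$ and $b$ denote the two letters in either order (the statement is understood up to exchanging them). For a non-empty word, its run-length encoding is $c_1^{n_1}\cdots c_k^{n_k}$ with $c_i\ne c_{i+1}$, $n_i\ge1$; $l(w)=k$. $\mathtt{BR}(w)=\{B_t\cdots B_1 : w=B_1\cdots B_t,\ t\ge1,\ B_i \text{ non-empty}\}$. A word $w$ is rich if it has exactly $|w|$ distinct non-empty palindromic factors. -}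

module Defs where

open import Data.Bool using (Bool; true; false; not; if_then_else_)
open import Data.Bool.Properties using () renaming (_≟_ to _≟ᵇ_)
open import Data.Nat using (ℕ; zero; suc; _+_; _<_; _≤_)
open import Data.List using (List; []; _∷_; _++_; length; reverse; concat; replicate)
open import Data.List.Membership.Propositional using (_∈_)
open import Data.List.Relation.Unary.All using (All)
open import Data.List.Relation.Unary.Unique.Propositional using (Unique)
open import Data.Product using (Σ; ∃; ∃-syntax; _×_; _,_)
open import Data.Sum using (_⊎_)
open import Relation.Binary.PropositionalEquality using (_≡_; _≢_)
open import Relation.Nullary using (does)
open import Function.Bundles using (_⇔_)

-- The two-letter alphabet {a,b} is modelled by Bool.
Word : Set
Word = List Bool

BinaryWord : Word → Set
BinaryWord w = (true ∈ w) × (false ∈ w)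

runsFrom : Bool → Word → ℕ
runsFrom c [] = 0
runsFrom c (y ∷ ys) = if does (c ≟ᵇ y) then runsFrom y ys else suc (runsFrom y ys)

l : Word → ℕ
l [] = 0
l (x ∷ xs) = suc (runsFrom x xs)

NonEmpty : Word → Set
NonEmpty u = 0 < length u

Factor : Word → Word → Set
Factor u w = ∃[ p ] ∃[ s ] (w ≡ p ++ u ++ s)

Palindrome : Word → Set
Palindrome u = reverse u ≡ u

NonEmptyPalFactor : Word → Word → Set
NonEmptyPalFactor w u = NonEmpty u × Palindrome u × Factor u w

Rich : Word → Set
Rich w = ∃[ L ] (Unique L × (∀ u → (u ∈ L ⇔ NonEmptyPalFactor w u)) × (length L ≡ length w))

InBR : Word → Word → Set
InBR w v = ∃[ Bs ] (0 < length Bs × All NonEmpty Bs × concat Bs ≡ w × v ≡ concat (reverse Bs))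

Form : Bool → Word → Set
Form a w =
    (∃[ n₁ ] ∃[ n₃ ] ∃[ n₅ ] (1 ≤ n₁ × 1 ≤ n₃ × 1 ≤ n₅ ×
       w ≡ replicate n₁ a ++ (b ∷ []) ++ replicate n₃ a ++ (b ∷ []) ++ replicate n₅ a))
  ⊎ (∃[ n₂ ] ∃[ n₄ ] (1 ≤ n₂ × 1 ≤ n₄ × n₂ + n₄ ≡ 4 ×
       w ≡ (a ∷ []) ++ replicate n₂ b ++ (a ∷ []) ++ replicate n₄ b ++ (a ∷ a ∷ [])))
  ⊎ (∃[ n₂ ] ∃[ n₄ ] (1 ≤ n₂ × 1 ≤ n₄ × n₂ + n₄ ≡ 4 ×
       w ≡ (a ∷ a ∷ []) ++ replicate n₂ b ++ (a ∷ []) ++ replicate n₄ b ++ (a ∷ [])))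
  ⊎ (∃[ n₂ ] ∃[ n₄ ] (1 ≤ n₂ × 1 ≤ n₄ × n₂ + n₄ ≡ 4 ×
       w ≡ (a ∷ []) ++ replicate n₂ b ++ (a ∷ a ∷ []) ++ replicate n₄ b ++ (a ∷ [])))
  where
  b : Bool
  b = not a

-- Appending a letter to a word creates at most one new palindromic factor, its longest
-- palindromic suffix. So a word w has at most |w| palindromic factors, and a factor u with fewer
-- than |u| of them keeps every word containing it below its length: richness passes to factors.
--
-- If n₂ = n₄ = 1, every element of BR(w) again has exactly two b's, and each word a^i b a^j b a^k
-- is rich: a^(t+1), a^t b a^t and a^t b a^j b a^t give exactly enough palindromes. The other three
-- forms leave nine short words, checked by computation. Every remaining five-run word is cut into
-- blocks near its run boundaries so that reversing the blocks produces a non-rich factor; as this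
-- factor reads only boundedly many letters at the ends of each run, one cutting serves a whole
-- family of run lengths, and a finite case split covers all of them.

module Submission where

open import Defs
open import Data.Bool using (Bool; true; false; not; _xor_; if_then_else_)
open import Data.Bool.Properties using (xor-same; not-¬) renaming (_≟_ to _≟ᵇ_)
open import Data.Empty using (⊥-elim)
open import Data.List using (List; []; _∷_; _++_; _∷ʳ_; length; reverse; concat; concatMap; map; replicate; take; drop; applyUpTo; deduplicate; initLast; _∷ʳ′_)
open import Data.List.Properties using (++-assoc; ++-identityʳ; length-++; length-reverse; length-applyUpTo; length-replicate; length-++-sucʳ; reverse-++; reverse-involutive; reverse-map; unfold-reverse; ∷ʳ-++; concat-++; take++drop≡id; ∷ʳ-injectiveˡ; ∷-injectiveˡ; ∷-injectiveʳ; ≡-dec)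
open import Data.List.Membership.Propositional using (_∈_; find)
open import Data.List.Membership.Propositional.Properties using (∈-++⁻; ∈-++⁺ˡ; ∈-++⁺ʳ; ∈-∃++; ∈-map⁺; ∈-concatMap⁺; ∈-applyUpTo⁻; ∈-deduplicate⁺; ∈-deduplicate⁻)
open import Data.List.Relation.Binary.Subset.Propositional using (_⊆_)
open import Data.List.Relation.Unary.All as All using (All; []; _∷_; all?)
open import Data.List.Relation.Unary.AllPairs using (_∷_)
open import Data.List.Relation.Unary.Any as Any using (Any; here; there; any?)
open import Data.List.Relation.Unary.Unique.Propositional using (Unique)
open import Data.List.Relation.Unary.Unique.Propositional.Properties using (++⁺; applyUpTo⁺₁)
import Data.List.Relation.Unary.Unique.DecPropositional.Properties as UniqueDec
open import Data.Nat using (ℕ; zero; suc; _+_; _∸_; _<_; _≤_; z≤n; s≤s; _≟_; _≤?_)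
open import Data.Nat.Properties using (module ≤-Reasoning; +-comm; +-assoc; +-cancelˡ-≤; +-cancelʳ-≤; ≤-antisym; ≤-total; ≤-trans; ≤⇒≯; <⇒≢; suc-injective; m≤n⇒∃[o]m+o≡n; m+1+n≢0)
open import Data.Nat.Solver using (module +-*-Solver)
open import Data.Product using (∃-syntax; _×_; _,_)
open import Data.Sum using (_⊎_; inj₁; inj₂)
open import Data.Unit using (tt)
open import Function using (_∘_)
open import Function.Bundles using (_⇔_; mk⇔; Equivalence)
open import Relation.Binary.Definitions using (DecidableEquality)
open import Relation.Binary.PropositionalEquality using (_≡_; _≢_; refl; sym; trans; cong; cong₂; subst; subst₂; module ≡-Reasoning)
open import Relation.Nullary using (¬_; yes; no)
open import Relation.Nullary.Decidable using (True; ¬?; map′; toWitness)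
open import Relation.Unary using (Decidable)

-- Palindromic factors and richness

unique⊆⇒length≤ : {A : Set} {xs ys : List A} → Unique xs → xs ⊆ ys → length xs ≤ length ys
unique⊆⇒length≤ {xs = []} _ _ = z≤n
unique⊆⇒length≤ {xs = x ∷ xs} (x∉xs ∷ xs!) xs⊆ys with ∈-∃++ (xs⊆ys (here refl))
... | ys₁ , ys₂ , refl = subst (suc (length xs) ≤_) (sym (length-++-sucʳ ys₁ x ys₂))
      (s≤s (unique⊆⇒length≤ xs! (λ z∈xs → skip x ys₁ (xs⊆ys (there z∈xs)) (All.lookup x∉xs z∈xs))))
  where
  skip : ∀ {z} x ys₁ {ys₂} → z ∈ ys₁ ++ x ∷ ys₂ → x ≢ z → z ∈ ys₁ ++ ys₂
  skip x ys₁ z∈ x≢z with ∈-++⁻ ys₁ z∈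
  ... | inj₁ z∈ys₁ = ∈-++⁺ˡ z∈ys₁
  ... | inj₂ (here refl) = ⊥-elim (x≢z refl)
  ... | inj₂ (there z∈ys₂) = ∈-++⁺ʳ ys₁ z∈ys₂

_≟ʷ_ : DecidableEquality Word
_≟ʷ_ = ≡-dec _≟ᵇ_

palindrome? : Decidable Palindrome
palindrome? u = reverse u ≟ʷ u

Factor-++ʳ : ∀ {u w} s → Factor u w → Factor u (w ++ s)
Factor-++ʳ {u} s (p , s′ , refl) = p , s′ ++ s , (begin
  (p ++ u ++ s′) ++ s ≡⟨ ++-assoc p (u ++ s′) s ⟩
  p ++ (u ++ s′) ++ s ≡⟨ cong (p ++_) (++-assoc u s′ s) ⟩
  p ++ u ++ s′ ++ s   ∎)
  where open ≡-Reasoning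

Factor-++ˡ : ∀ {u w} p → Factor u w → Factor u (p ++ w)
Factor-++ˡ {u} p (p′ , s , refl) = p ++ p′ , s , sym (++-assoc p p′ (u ++ s))

Factor-reverse : ∀ {u w} → Factor u w → Factor (reverse u) (reverse w)
Factor-reverse {u} (p , s , refl) = reverse s , reverse p , (begin
  reverse (p ++ u ++ s)                 ≡⟨ reverse-++ p (u ++ s) ⟩
  reverse (u ++ s) ++ reverse p         ≡⟨ cong (_++ reverse p) (reverse-++ u s) ⟩
  (reverse s ++ reverse u) ++ reverse p ≡⟨ ++-assoc (reverse s) (reverse u) (reverse p) ⟩
  reverse s ++ reverse u ++ reverse p   ∎)
  where open ≡-Reasoning

¬Factor[] : ∀ {u} → NonEmpty u → ¬ Factor u []
¬Factor[] {_ ∷ _} _ ([] , _ , ())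
¬Factor[] {_ ∷ _} _ (_ ∷ _ , _ , ())

longestPalSuffix : Word → Word
longestPalSuffix [] = []
longestPalSuffix (x ∷ u) with palindrome? (x ∷ u)
... | yes _ = x ∷ u
... | no _ = longestPalSuffix u

longestPalSuffix-suffix : ∀ w → ∃[ t ] (w ≡ t ++ longestPalSuffix w)
longestPalSuffix-suffix [] = [] , refl
longestPalSuffix-suffix (x ∷ u) with palindrome? (x ∷ u)
... | yes _ = [] , refl
... | no _ with t , eq ← longestPalSuffix-suffix u = x ∷ t , cong (x ∷_) eq

longestPalSuffix-palindrome : ∀ w → Palindrome (longestPalSuffix w)
longestPalSuffix-palindrome [] = refl
longestPalSuffix-palindrome (x ∷ u) with palindrome? (x ∷ u)
... | yes pal = pal
... | no _ = longestPalSuffix-palindrome u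

longestPalSuffix-longest : ∀ w t {s} → Palindrome s → w ≡ t ++ s → ∃[ t′ ] (longestPalSuffix w ≡ t′ ++ s)
longestPalSuffix-longest [] t _ eq = t , eq
longestPalSuffix-longest (x ∷ u) t pal eq with palindrome? (x ∷ u)
longestPalSuffix-longest (x ∷ u) t pal eq | yes _ = t , eq
longestPalSuffix-longest (x ∷ u) [] pal refl | no ¬pal = ⊥-elim (¬pal pal)
longestPalSuffix-longest (x ∷ u) (_ ∷ t) pal eq | no _ = longestPalSuffix-longest u t pal (∷-injectiveʳ eq)

longestPalSuffix-nonEmpty : ∀ x c → NonEmpty (longestPalSuffix (x ∷ʳ c))
longestPalSuffix-nonEmpty x c with longestPalSuffix-longest (x ∷ʳ c) x {c ∷ []} refl refl
... | [] , eq = subst NonEmpty (sym eq) (s≤s z≤n)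
... | _ ∷ _ , eq = subst NonEmpty (sym eq) (s≤s z≤n)

Factor-of-init : ∀ {q} x c p s d → x ∷ʳ c ≡ p ++ q ++ (s ∷ʳ d) → Factor q x
Factor-of-init {q} x c p s d eq = p , s , ∷ʳ-injectiveˡ x (p ++ q ++ s) (begin
  x ∷ʳ c              ≡⟨ eq ⟩
  p ++ q ++ s ++ d ∷ [] ≡⟨ cong (p ++_) (++-assoc q s (d ∷ [])) ⟨
  p ++ (q ++ s) ∷ʳ d  ≡⟨ ++-assoc p (q ++ s) (d ∷ []) ⟨
  (p ++ q ++ s) ∷ʳ d  ∎)
  where open ≡-Reasoning

-- A palindromic proper suffix of the palindrome longestPalSuffix (x ∷ʳ c) is mirrored at its
-- start, so it also occurs inside x.
palindromicFactor-∷ʳ : ∀ {q} x c → Palindrome q → Factor q (x ∷ʳ c) →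
                       Factor q x ⊎ q ≡ longestPalSuffix (x ∷ʳ c)
palindromicFactor-∷ʳ {q} x c pal (p , s , eq) with initLast s
... | s′ ∷ʳ′ d = inj₁ (Factor-of-init x c p s′ d eq)
... | [] with longestPalSuffix-longest (x ∷ʳ c) p pal (trans eq (cong (p ++_) (++-identityʳ _)))
...   | [] , lps≡q = inj₂ (sym lps≡q)
...   | y ∷ t , lps≡ytq with longestPalSuffix-suffix (x ∷ʳ c)
...     | t″ , w≡t″lps = inj₁ (Factor-of-init x c t″ (reverse t) y (trans w≡t″lps (cong (t″ ++_) lps≡qty)))
  where
  open ≡-Reasoning
  lps≡qty : longestPalSuffix (x ∷ʳ c) ≡ q ++ reverse t ∷ʳ y
  lps≡qty = begin
    longestPalSuffix (x ∷ʳ c)          ≡⟨ longestPalSuffix-palindrome (x ∷ʳ c) ⟨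
    reverse (longestPalSuffix (x ∷ʳ c)) ≡⟨ cong reverse lps≡ytq ⟩
    reverse ((y ∷ t) ++ q)             ≡⟨ reverse-++ (y ∷ t) q ⟩
    reverse q ++ reverse (y ∷ t)       ≡⟨ cong₂ _++_ pal (unfold-reverse y t) ⟩
    q ++ reverse t ∷ʳ y                ∎

lpsOfPrefixes : Word → Word → List Word
lpsOfPrefixes x [] = []
lpsOfPrefixes x (c ∷ y) = longestPalSuffix (x ∷ʳ c) ∷ lpsOfPrefixes (x ∷ʳ c) y

length-lpsOfPrefixes : ∀ x y → length (lpsOfPrefixes x y) ≡ length y
length-lpsOfPrefixes x [] = refl
length-lpsOfPrefixes x (c ∷ y) = cong suc (length-lpsOfPrefixes (x ∷ʳ c) y)

lpsOfPrefixes-sound : ∀ {q} x y → q ∈ lpsOfPrefixes x y → NonEmptyPalFactor (x ++ y) q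
lpsOfPrefixes-sound x (c ∷ y) (here refl) with t , eq ← longestPalSuffix-suffix (x ∷ʳ c) =
  longestPalSuffix-nonEmpty x c , longestPalSuffix-palindrome (x ∷ʳ c) ,
  subst (Factor _) (∷ʳ-++ x c y) (Factor-++ʳ y (t , [] , trans eq (sym (cong (t ++_) (++-identityʳ _)))))
lpsOfPrefixes-sound x (c ∷ y) (there q∈) with ne , pal , fac ← lpsOfPrefixes-sound (x ∷ʳ c) y q∈ =
  ne , pal , subst (Factor _) (∷ʳ-++ x c y) fac

palindromicFactor-++ : ∀ {q} x y → Palindrome q → Factor q (x ++ y) → Factor q x ⊎ q ∈ lpsOfPrefixes x y
palindromicFactor-++ x [] pal fac = inj₁ (subst (Factor _) (++-identityʳ x) fac)
palindromicFactor-++ x (c ∷ y) pal fac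
  with palindromicFactor-++ (x ∷ʳ c) y pal (subst (Factor _) (sym (∷ʳ-++ x c y)) fac)
... | inj₂ q∈ = inj₂ (there q∈)
... | inj₁ fac′ with palindromicFactor-∷ʳ x c pal fac′
...   | inj₁ fac″ = inj₁ fac″
...   | inj₂ q≡ = inj₂ (here q≡)

palindromicFactor-++ˡ : ∀ {q} y x → Palindrome q → Factor q (y ++ x) →
                        Factor q x ⊎ q ∈ lpsOfPrefixes (reverse x) (reverse y)
palindromicFactor-++ˡ {q} y x pal fac
  with palindromicFactor-++ (reverse x) (reverse y) pal
         (subst₂ Factor pal (reverse-++ y x) (Factor-reverse fac))
... | inj₂ q∈ = inj₂ q∈
... | inj₁ fac′ = inj₁ (subst₂ Factor pal (reverse-involutive x) (Factor-reverse fac′))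

palindromes : Word → List Word
palindromes w = deduplicate _≟ʷ_ (lpsOfPrefixes [] w)

palindromes-unique : ∀ w → Unique (palindromes w)
palindromes-unique w = UniqueDec.deduplicate-! _≟ʷ_ (lpsOfPrefixes [] w)

palindromes-sound : ∀ {q} w → q ∈ palindromes w → NonEmptyPalFactor w q
palindromes-sound w q∈ = lpsOfPrefixes-sound [] w (∈-deduplicate⁻ _≟ʷ_ (lpsOfPrefixes [] w) q∈)

palindromes-complete : ∀ {q} w → NonEmptyPalFactor w q → q ∈ palindromes w
palindromes-complete w (ne , pal , fac) with palindromicFactor-++ [] w pal fac
... | inj₁ fac[] = ⊥-elim (¬Factor[] ne fac[])
... | inj₂ q∈ = ∈-deduplicate⁺ _≟ʷ_ q∈

palindromes-length≤ : ∀ w → length (palindromes w) ≤ length w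
palindromes-length≤ w = subst (length (palindromes w) ≤_) (length-lpsOfPrefixes [] w)
  (unique⊆⇒length≤ (palindromes-unique w) (∈-deduplicate⁻ _≟ʷ_ (lpsOfPrefixes [] w)))

Rich⇒palindromes-length : ∀ w → Rich w → length (palindromes w) ≡ length w
Rich⇒palindromes-length w (L , L! , L⇔ , |L|≡|w|) = trans (≤-antisym
  (unique⊆⇒length≤ (palindromes-unique w) λ q∈ → Equivalence.from (L⇔ _) (palindromes-sound w q∈))
  (unique⊆⇒length≤ L! λ q∈ → palindromes-complete w (Equivalence.to (L⇔ _) q∈))) |L|≡|w|

palindromes-length⇒Rich : ∀ w → length (palindromes w) ≡ length w → Rich w
palindromes-length⇒Rich w eq =
  palindromes w , palindromes-unique w , (λ q → mk⇔ (palindromes-sound w) (palindromes-complete w)) , eq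

rich? : Decidable Rich
rich? w = map′ (palindromes-length⇒Rich w) (Rich⇒palindromes-length w) (length (palindromes w) ≟ length w)

palindromes-factor-length : ∀ p u s →
  length (palindromes (p ++ u ++ s)) ≤ length p + (length (palindromes u) + length s)
palindromes-factor-length p u s = subst (length (palindromes (p ++ u ++ s)) ≤_) cover-length
  (unique⊆⇒length≤ (palindromes-unique (p ++ u ++ s)) covered)
  where
  outside : List Word
  outside = lpsOfPrefixes (reverse (u ++ s)) (reverse p)
  covered : palindromes (p ++ u ++ s) ⊆ outside ++ palindromes u ++ lpsOfPrefixes u s
  covered q∈ with ne , pal , fac ← palindromes-sound _ q∈ | palindromicFactor-++ˡ p (u ++ s) pal fac
  ... | inj₂ q∈out = ∈-++⁺ˡ q∈out
  ... | inj₁ fac′ with palindromicFactor-++ u s pal fac′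
  ...   | inj₁ fac″ = ∈-++⁺ʳ outside (∈-++⁺ˡ (palindromes-complete u (ne , pal , fac″)))
  ...   | inj₂ q∈s = ∈-++⁺ʳ outside (∈-++⁺ʳ (palindromes u) q∈s)
  open ≡-Reasoning
  cover-length : length (outside ++ palindromes u ++ lpsOfPrefixes u s) ≡ length p + (length (palindromes u) + length s)
  cover-length = begin
    length (outside ++ palindromes u ++ lpsOfPrefixes u s)
      ≡⟨ length-++ outside ⟩
    length outside + length (palindromes u ++ lpsOfPrefixes u s)
      ≡⟨ cong₂ _+_ (trans (length-lpsOfPrefixes _ (reverse p)) (length-reverse p)) (length-++ (palindromes u)) ⟩
    length p + (length (palindromes u) + length (lpsOfPrefixes u s))
      ≡⟨ cong (λ n → length p + (length (palindromes u) + n)) (length-lpsOfPrefixes u s) ⟩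
    length p + (length (palindromes u) + length s) ∎

Rich-factor : ∀ {u v} → Factor u v → Rich v → Rich u
Rich-factor {u} (p , s , refl) rich = palindromes-length⇒Rich u (≤-antisym (palindromes-length≤ u)
  (+-cancelʳ-≤ (length s) _ _ (+-cancelˡ-≤ (length p) _ _ (begin
    length p + (length u + length s)        ≡⟨ cong (length p +_) (length-++ u) ⟨
    length p + length (u ++ s)              ≡⟨ length-++ p ⟨
    length (p ++ u ++ s)                    ≡⟨ Rich⇒palindromes-length _ rich ⟨
    length (palindromes (p ++ u ++ s))      ≤⟨ palindromes-factor-length p u s ⟩
    length p + (length (palindromes u) + length s) ∎))))
  where open ≤-Reasoning

Rich-byPalindromes : ∀ w {L} → Unique L → (∀ {q} → q ∈ L → NonEmptyPalFactor w q) → length L ≡ length w → Rich w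
Rich-byPalindromes w L! sound |L|≡|w| = palindromes-length⇒Rich w (≤-antisym (palindromes-length≤ w)
  (subst (_≤ length (palindromes w)) |L|≡|w| (unique⊆⇒length≤ L! (λ q∈ → palindromes-complete w (sound q∈)))))

-- Reversed block decompositions

BRRich : Word → Set
BRRich w = ∀ v → InBR w v → Rich v

dropEmpty : List Word → List Word
dropEmpty [] = []
dropEmpty ([] ∷ Bs) = dropEmpty Bs
dropEmpty ((x ∷ B) ∷ Bs) = (x ∷ B) ∷ dropEmpty Bs

dropEmpty-nonEmpty : ∀ Bs → All NonEmpty (dropEmpty Bs)
dropEmpty-nonEmpty [] = []
dropEmpty-nonEmpty ([] ∷ Bs) = dropEmpty-nonEmpty Bs
dropEmpty-nonEmpty ((x ∷ B) ∷ Bs) = s≤s z≤n ∷ dropEmpty-nonEmpty Bs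

dropEmpty-length : ∀ Bs → NonEmpty (concat Bs) → 0 < length (dropEmpty Bs)
dropEmpty-length ([] ∷ Bs) ne = dropEmpty-length Bs ne
dropEmpty-length ((x ∷ B) ∷ Bs) _ = s≤s z≤n

concat-dropEmpty : ∀ Bs → concat (dropEmpty Bs) ≡ concat Bs
concat-dropEmpty [] = refl
concat-dropEmpty ([] ∷ Bs) = concat-dropEmpty Bs
concat-dropEmpty ((x ∷ B) ∷ Bs) = cong ((x ∷ B) ++_) (concat-dropEmpty Bs)

concat-reverse-∷ : ∀ (B : Word) Bs → concat (reverse (B ∷ Bs)) ≡ concat (reverse Bs) ++ B
concat-reverse-∷ B Bs = begin
  concat (reverse (B ∷ Bs))             ≡⟨ cong concat (unfold-reverse B Bs) ⟩
  concat (reverse Bs ++ B ∷ [])         ≡⟨ concat-++ (reverse Bs) (B ∷ []) ⟨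
  concat (reverse Bs) ++ B ++ []        ≡⟨ cong (concat (reverse Bs) ++_) (++-identityʳ B) ⟩
  concat (reverse Bs) ++ B              ∎
  where open ≡-Reasoning

concat-reverse-dropEmpty : ∀ Bs → concat (reverse (dropEmpty Bs)) ≡ concat (reverse Bs)
concat-reverse-dropEmpty [] = refl
concat-reverse-dropEmpty ([] ∷ Bs) = begin
  concat (reverse (dropEmpty Bs)) ≡⟨ concat-reverse-dropEmpty Bs ⟩
  concat (reverse Bs)             ≡⟨ ++-identityʳ _ ⟨
  concat (reverse Bs) ++ []       ≡⟨ concat-reverse-∷ [] Bs ⟨
  concat (reverse ([] ∷ Bs))      ∎
  where open ≡-Reasoning
concat-reverse-dropEmpty (B@(_ ∷ _) ∷ Bs) = begin
  concat (reverse (B ∷ dropEmpty Bs)) ≡⟨ concat-reverse-∷ B (dropEmpty Bs) ⟩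
  concat (reverse (dropEmpty Bs)) ++ B ≡⟨ cong (_++ B) (concat-reverse-dropEmpty Bs) ⟩
  concat (reverse Bs) ++ B            ≡⟨ concat-reverse-∷ B Bs ⟨
  concat (reverse (B ∷ Bs))           ∎
  where open ≡-Reasoning

reverseBlocks∈BR : ∀ Bs → NonEmpty (concat Bs) → InBR (concat Bs) (concat (reverse Bs))
reverseBlocks∈BR Bs ne = dropEmpty Bs , dropEmpty-length Bs ne , dropEmpty-nonEmpty Bs ,
  concat-dropEmpty Bs , sym (concat-reverse-dropEmpty Bs)

prependLetter : Bool → List Word → List (List Word)
prependLetter x [] = ((x ∷ []) ∷ []) ∷ []
prependLetter x (B ∷ Bs) = ((x ∷ []) ∷ B ∷ Bs) ∷ ((x ∷ B) ∷ Bs) ∷ []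

blockDecompositions : Word → List (List Word)
blockDecompositions [] = [] ∷ []
blockDecompositions (x ∷ w) = concatMap (prependLetter x) (blockDecompositions w)

blockDecompositions-complete : ∀ Bs → All NonEmpty Bs → Bs ∈ blockDecompositions (concat Bs)
blockDecompositions-complete [] _ = here refl
blockDecompositions-complete ([] ∷ _) (() ∷ _)
blockDecompositions-complete ((x ∷ []) ∷ []) _ = ∈-concatMap⁺ (prependLetter x) {xs = [] ∷ []} (here (here refl))
blockDecompositions-complete ((x ∷ []) ∷ B ∷ Bs) (_ ∷ ne) =
  ∈-concatMap⁺ (prependLetter x) (Any.map (λ { refl → here refl }) (blockDecompositions-complete (B ∷ Bs) ne))
blockDecompositions-complete ((x ∷ y ∷ B) ∷ Bs) (_ ∷ ne) =
  ∈-concatMap⁺ (prependLetter x) (Any.map (λ { refl → there (here refl) }) (blockDecompositions-complete ((y ∷ B) ∷ Bs) (s≤s z≤n ∷ ne)))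

brList : Word → List Word
brList w = map (concat ∘ reverse) (blockDecompositions w)

InBR⇒∈brList : ∀ {w v} → InBR w v → v ∈ brList w
InBR⇒∈brList (Bs , _ , ne , refl , refl) = ∈-map⁺ (concat ∘ reverse) (blockDecompositions-complete Bs ne)

BRRich-byComputation : ∀ w → True (all? rich? (brList w)) → BRRich w
BRRich-byComputation w ok v v∈BR = All.lookup (toWitness ok) (InBR⇒∈brList v∈BR)

-- Words with symbolic stretches

-- A pad stands for a stretch of letters that is never inspected: segments only reads the
-- letter pieces, so checks on segments evaluate even when pads have symbolic length.
data Piece : Set where
  letter : Bool → Piece
  pad    : Word → Piece

spell : List Piece → Word
spell [] = []
spell (letter c ∷ ps) = c ∷ spell ps
spell (pad u ∷ ps) = u ++ spell ps

spell-++ : ∀ ps qs → spell (ps ++ qs) ≡ spell ps ++ spell qs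
spell-++ [] qs = refl
spell-++ (letter c ∷ ps) qs = cong (c ∷_) (spell-++ ps qs)
spell-++ (pad u ∷ ps) qs = trans (cong (u ++_) (spell-++ ps qs)) (sym (++-assoc u (spell ps) (spell qs)))

spell-concat : ∀ pss → spell (concat pss) ≡ concat (map spell pss)
spell-concat [] = refl
spell-concat (ps ∷ pss) = trans (spell-++ ps (concat pss)) (cong (spell ps ++_) (spell-concat pss))

leadingLetters : List Piece → Word
leadingLetters (letter c ∷ ps) = c ∷ leadingLetters ps
leadingLetters _ = []

segments : List Piece → List Word
laterSegments : List Piece → List Word

segments ps = leadingLetters ps ∷ laterSegments ps

laterSegments [] = []
laterSegments (letter _ ∷ ps) = laterSegments ps
laterSegments (pad _ ∷ ps) = segments ps

leadingLetters-prefix : ∀ ps → ∃[ s ] (spell ps ≡ leadingLetters ps ++ s)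
leadingLetters-prefix [] = [] , refl
leadingLetters-prefix (letter c ∷ ps) with s , eq ← leadingLetters-prefix ps = s , cong (c ∷_) eq
leadingLetters-prefix (pad u ∷ ps) = u ++ spell ps , refl

segments-factor : ∀ ps {u} → u ∈ segments ps → Factor u (spell ps)
segments-factor ps (here refl) with s , eq ← leadingLetters-prefix ps = [] , s , eq
segments-factor (letter c ∷ ps) (there u∈) = Factor-++ˡ (c ∷ []) (segments-factor ps (there u∈))
segments-factor (pad v ∷ ps) (there u∈) = Factor-++ˡ v (segments-factor ps u∈)

groups : {A : Set} → List ℕ → List A → List (List A)
groups [] xs = xs ∷ []
groups (n ∷ ns) xs = take n xs ∷ groups ns (drop n xs)

concat-groups : {A : Set} (ns : List ℕ) (xs : List A) → concat (groups ns xs) ≡ xs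
concat-groups [] xs = ++-identityʳ xs
concat-groups (n ∷ ns) xs = trans (cong (take n xs ++_) (concat-groups ns (drop n xs))) (take++drop≡id n xs)

¬BRRich-byReversedGroups : ∀ ns ps → NonEmpty (spell ps) →
  Any (¬_ ∘ Rich) (segments (concat (reverse (groups ns ps)))) → ¬ BRRich (spell ps)
¬BRRich-byReversedGroups ns ps ne nonRich brRich with u , u∈ , ¬rich ← find nonRich =
  ¬rich (Rich-factor (segments-factor (concat (reverse G)) u∈) (subst Rich v≡ (brRich v v∈BR)))
  where
  open ≡-Reasoning
  G : List (List Piece)
  G = groups ns ps
  Bs : List Word
  Bs = map spell G
  concat-Bs : concat Bs ≡ spell ps
  concat-Bs = trans (sym (spell-concat G)) (cong spell (concat-groups ns ps))
  v : Word
  v = concat (reverse Bs)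
  v≡ : v ≡ spell (concat (reverse G))
  v≡ = begin
    concat (reverse (map spell G)) ≡⟨ cong concat (reverse-map spell G) ⟨
    concat (map spell (reverse G)) ≡⟨ spell-concat (reverse G) ⟨
    spell (concat (reverse G))     ∎
  v∈BR : InBR (spell ps) v
  v∈BR = subst (λ w → InBR w v) concat-Bs (reverseBlocks∈BR Bs (subst NonEmpty (sym concat-Bs) ne))

alternating : Bool → Bool → List ℕ → Word
alternating x y [] = []
alternating x y (n ∷ []) = replicate n x
alternating x y (n ∷ m ∷ ns) = replicate n x ++ alternating y x (m ∷ ns)

data RunShape : Set where
  exactly : ℕ → RunShape
  padded  : ℕ → ℕ → ℕ → RunShape

-- padded k e m: k letters, a pad of e letters, m letters. The length is written k + m + e so
-- that for numerals k and m it reduces to a successor of e, as in the case split below.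
runLength : RunShape → ℕ
runLength (exactly n) = n
runLength (padded k e m) = k + m + e

runPieces : Bool → RunShape → List Piece
runPieces c (exactly n) = replicate n (letter c)
runPieces c (padded k e m) = replicate k (letter c) ++ pad (replicate e c) ∷ replicate m (letter c)

alternatingPieces : Bool → Bool → List RunShape → List Piece
alternatingPieces x y [] = []
alternatingPieces x y (s ∷ []) = runPieces x s
alternatingPieces x y (s ∷ t ∷ ss) = runPieces x s ++ alternatingPieces y x (t ∷ ss)

spell-replicate : ∀ n c → spell (replicate n (letter c)) ≡ replicate n c
spell-replicate zero c = refl
spell-replicate (suc n) c = cong (c ∷_) (spell-replicate n c)

replicate-+ : ∀ m n (c : Bool) → replicate (m + n) c ≡ replicate m c ++ replicate n c
replicate-+ zero n c = refl
replicate-+ (suc m) n c = cong (c ∷_) (replicate-+ m n c)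

spell-runPieces : ∀ c s → spell (runPieces c s) ≡ replicate (runLength s) c
spell-runPieces c (exactly n) = spell-replicate n c
spell-runPieces c (padded k e m) = begin
  spell (replicate k (letter c) ++ pad (replicate e c) ∷ replicate m (letter c))
    ≡⟨ spell-++ (replicate k (letter c)) _ ⟩
  spell (replicate k (letter c)) ++ replicate e c ++ spell (replicate m (letter c))
    ≡⟨ cong₂ (λ u v → u ++ replicate e c ++ v) (spell-replicate k c) (spell-replicate m c) ⟩
  replicate k c ++ replicate e c ++ replicate m c
    ≡⟨ cong (replicate k c ++_) (replicate-+ e m c) ⟨
  replicate k c ++ replicate (e + m) c
    ≡⟨ replicate-+ k (e + m) c ⟨
  replicate (k + (e + m)) c
    ≡⟨ cong (λ n → replicate (k + n) c) (+-comm e m) ⟩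
  replicate (k + (m + e)) c
    ≡⟨ cong (λ n → replicate n c) (+-assoc k m e) ⟨
  replicate (k + m + e) c ∎
  where open ≡-Reasoning

spell-alternatingPieces : ∀ x y ss → spell (alternatingPieces x y ss) ≡ alternating x y (map runLength ss)
spell-alternatingPieces x y [] = refl
spell-alternatingPieces x y (s ∷ []) = spell-runPieces x s
spell-alternatingPieces x y (s ∷ t ∷ ss) =
  trans (spell-++ (runPieces x s) _) (cong₂ _++_ (spell-runPieces x s) (spell-alternatingPieces y x (t ∷ ss)))

reversedGroupSegments : Bool → List RunShape → List ℕ → List Word
reversedGroupSegments c ss ns = segments (concat (reverse (groups ns (alternatingPieces c (not c) ss))))

¬BRRich-alternating : ∀ c ss ns → Any (¬_ ∘ Rich) (reversedGroupSegments c ss ns) →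
  NonEmpty (alternating c (not c) (map runLength ss)) → ¬ BRRich (alternating c (not c) (map runLength ss))
¬BRRich-alternating c ss ns nonRich ne brRich =
  ¬BRRich-byReversedGroups ns (alternatingPieces c (not c) ss) (subst NonEmpty (sym spell≡) ne) nonRich
    (subst BRRich (sym spell≡) brRich)
  where
  spell≡ : spell (alternatingPieces c (not c) ss) ≡ alternating c (not c) (map runLength ss)
  spell≡ = spell-alternatingPieces c (not c) ss

¬BRRich-byComputation : ∀ a ss ns →
  True (any? (¬? ∘ rich?) (reversedGroupSegments true ss ns)) →
  True (any? (¬? ∘ rich?) (reversedGroupSegments false ss ns)) →
  NonEmpty (alternating a (not a) (map runLength ss)) → ¬ BRRich (alternating a (not a) (map runLength ss))
¬BRRich-byComputation true ss ns ok _ = ¬BRRich-alternating true ss ns (toWitness ok)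
¬BRRich-byComputation false ss ns _ ok = ¬BRRich-alternating false ss ns (toWitness ok)

-- Words with exactly two b's

countOther : Bool → Word → ℕ
countOther a [] = 0
countOther a (x ∷ v) = if x xor a then suc (countOther a v) else countOther a v

countOther-++ : ∀ a u v → countOther a (u ++ v) ≡ countOther a u + countOther a v
countOther-++ a [] v = refl
countOther-++ a (x ∷ u) v with x xor a
... | true = cong suc (countOther-++ a u v)
... | false = countOther-++ a u v

countOther-replicate : ∀ a n → countOther a (replicate n a) ≡ 0
countOther-replicate a zero = refl
countOther-replicate a (suc n) rewrite xor-same a = countOther-replicate a n

countOther-not : ∀ a v → countOther a (not a ∷ v) ≡ suc (countOther a v)
countOther-not true v = refl
countOther-not false v = refl

countOther-replicate-not : ∀ a m u → countOther a (replicate m a ++ not a ∷ u) ≡ suc (countOther a u)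
countOther-replicate-not a m u =
  trans (countOther-++ a (replicate m a) (not a ∷ u)) (cong₂ _+_ (countOther-replicate a m) (countOther-not a u))

countOther-concat-reverse : ∀ a Bs → countOther a (concat (reverse Bs)) ≡ countOther a (concat Bs)
countOther-concat-reverse a [] = refl
countOther-concat-reverse a (B ∷ Bs) = begin
  countOther a (concat (reverse (B ∷ Bs)))             ≡⟨ cong (countOther a) (concat-reverse-∷ B Bs) ⟩
  countOther a (concat (reverse Bs) ++ B)              ≡⟨ countOther-++ a (concat (reverse Bs)) B ⟩
  countOther a (concat (reverse Bs)) + countOther a B  ≡⟨ cong (_+ countOther a B) (countOther-concat-reverse a Bs) ⟩
  countOther a (concat Bs) + countOther a B            ≡⟨ +-comm (countOther a (concat Bs)) (countOther a B) ⟩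
  countOther a B + countOther a (concat Bs)            ≡⟨ countOther-++ a B (concat Bs) ⟨
  countOther a (concat (B ∷ Bs))                       ∎
  where open ≡-Reasoning

countOther≡0 : ∀ a v → countOther a v ≡ 0 → v ≡ replicate (length v) a
countOther≡0 a [] _ = refl
countOther≡0 true (true ∷ v) eq = cong (true ∷_) (countOther≡0 true v eq)
countOther≡0 false (false ∷ v) eq = cong (false ∷_) (countOther≡0 false v eq)

countOther≡suc : ∀ a v {n} → countOther a v ≡ suc n → ∃[ i ] ∃[ z ] (v ≡ replicate i a ++ not a ∷ z × countOther a z ≡ n)
countOther≡suc true (false ∷ v) eq = 0 , v , refl , suc-injective eq
countOther≡suc false (true ∷ v) eq = 0 , v , refl , suc-injective eq
countOther≡suc true (true ∷ v) eq with i , z , refl , eq′ ← countOther≡suc true v eq = suc i , z , refl , eq′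
countOther≡suc false (false ∷ v) eq with i , z , refl , eq′ ← countOther≡suc false v eq = suc i , z , refl , eq′

twoB : Bool → ℕ → ℕ → ℕ → Word
twoB a i j k = replicate i a ++ not a ∷ replicate j a ++ not a ∷ replicate k a

length-twoB : ∀ a i j k → length (twoB a i j k) ≡ i + suc (j + suc k)
length-twoB a i j k = trans (length-++ (replicate i a)) (cong₂ (λ p q → p + suc q) (length-replicate i)
  (trans (length-++ (replicate j a)) (cong₂ (λ p q → p + suc q) (length-replicate j) (length-replicate k))))

twoB-mirror : ∀ a i j k → twoB a i j k ≡ replicate i a ++ (not a ∷ replicate j a ++ not a ∷ []) ++ replicate k a
twoB-mirror a i j k = cong (λ u → replicate i a ++ not a ∷ u) (sym (++-assoc (replicate j a) (not a ∷ []) (replicate k a)))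

countOther≡2 : ∀ a v → countOther a v ≡ 2 → ∃[ i ] ∃[ j ] ∃[ k ] (v ≡ twoB a i j k)
countOther≡2 a v eq with i , z , refl , eq′ ← countOther≡suc a v eq
                    with j , z′ , refl , eq″ ← countOther≡suc a z eq′ = i , j , length z′ , cong (λ u → replicate i a ++ not a ∷ replicate j a ++ not a ∷ u) (countOther≡0 a z′ eq″)

countOther-twoB : ∀ a i j k → countOther a (twoB a i j k) ≡ 2
countOther-twoB a i j k = trans (countOther-replicate-not a i _)
  (cong suc (trans (countOther-replicate-not a j _) (cong suc (countOther-replicate a k))))

replicate-+ʳ : ∀ {s x} (c : Bool) → s ≤ x → ∃[ d ] (replicate x c ≡ replicate s c ++ replicate d c)
replicate-+ʳ {s} c s≤x with d , refl ← m≤n⇒∃[o]m+o≡n s≤x = d , replicate-+ s d c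

replicate-+ˡ : ∀ {s x} (c : Bool) → s ≤ x → ∃[ d ] (replicate x c ≡ replicate d c ++ replicate s c)
replicate-+ˡ {s} c s≤x with d , refl ← m≤n⇒∃[o]m+o≡n s≤x =
  d , trans (cong (λ n → replicate n c) (+-comm s d)) (replicate-+ d s c)

Factor-replicate : ∀ {s x} (c : Bool) → s ≤ x → Factor (replicate s c) (replicate x c)
Factor-replicate {s} c s≤x with d , eq ← replicate-+ʳ c s≤x = [] , replicate d c , eq

Factor-mirror : ∀ {s x y} (c : Bool) m → s ≤ x → s ≤ y →
  Factor (replicate s c ++ m ++ replicate s c) (replicate x c ++ m ++ replicate y c)
Factor-mirror {s} {x} {y} c m s≤x s≤y with d₁ , eq₁ ← replicate-+ˡ c s≤x | d₂ , eq₂ ← replicate-+ʳ c s≤y =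
  replicate d₁ c , replicate d₂ c , (begin
    replicate x c ++ m ++ replicate y c ≡⟨ cong₂ (λ u v → u ++ m ++ v) eq₁ eq₂ ⟩
    (D₁ ++ S) ++ m ++ (S ++ D₂)         ≡⟨ ++-assoc D₁ S (m ++ S ++ D₂) ⟩
    D₁ ++ S ++ m ++ S ++ D₂             ≡⟨ cong (λ u → D₁ ++ S ++ u) (++-assoc m S D₂) ⟨
    D₁ ++ S ++ (m ++ S) ++ D₂           ≡⟨ cong (D₁ ++_) (++-assoc S (m ++ S) D₂) ⟨
    D₁ ++ (S ++ m ++ S) ++ D₂           ∎)
  where
  open ≡-Reasoning
  S D₁ D₂ : Word
  S = replicate s c
  D₁ = replicate d₁ c
  D₂ = replicate d₂ c

replicate-palindrome : ∀ n (c : Bool) → Palindrome (replicate n c)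
replicate-palindrome zero c = refl
replicate-palindrome (suc n) c = begin
  reverse (c ∷ replicate n c)       ≡⟨ unfold-reverse c (replicate n c) ⟩
  reverse (replicate n c) ++ c ∷ [] ≡⟨ cong (_++ c ∷ []) (replicate-palindrome n c) ⟩
  replicate n c ++ replicate 1 c    ≡⟨ replicate-+ n 1 c ⟨
  replicate (n + 1) c               ≡⟨ cong (λ k → replicate k c) (+-comm n 1) ⟩
  replicate (suc n) c               ∎
  where open ≡-Reasoning

palindrome-mirror : ∀ {u m} → Palindrome u → Palindrome m → Palindrome (u ++ m ++ u)
palindrome-mirror {u} {m} pu pm = begin
  reverse (u ++ m ++ u)                 ≡⟨ reverse-++ u (m ++ u) ⟩
  reverse (m ++ u) ++ reverse u         ≡⟨ cong (_++ reverse u) (reverse-++ m u) ⟩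
  (reverse u ++ reverse m) ++ reverse u ≡⟨ cong₂ (λ x y → (x ++ y) ++ x) pu pm ⟩
  (u ++ m) ++ u                         ≡⟨ ++-assoc u m u ⟩
  u ++ m ++ u                           ∎
  where open ≡-Reasoning

open +-*-Solver using (solve; _:+_; _:=_; con)

-- The palindromic factors of a^i b a^j b a^k are a^(t+1) for t < powers, a^t b a^t for
-- t ≤ centred and a^t b a^j b a^t for t ≤ framed.
record TwoBCounts (i j k : ℕ) : Set where
  field
    powers centred framed : ℕ
    total : powers + centred + framed ≡ i + j + k
    power-fits : ∀ {t} → t < powers → t < i ⊎ t < j ⊎ t < k
    centred-fits : ∀ {t} → t ≤ centred → (t ≤ i × t ≤ j) ⊎ (t ≤ j × t ≤ k)
    framed-fits : ∀ {t} → t ≤ framed → t ≤ i × t ≤ k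

twoBCounts : ∀ i j k → TwoBCounts i j k
twoBCounts i j k with ≤-total j i | ≤-total k i | ≤-total k j | ≤-total i k
... | inj₁ j≤i | inj₁ k≤i | _ | _ = record
  { powers = i ; centred = j ; framed = k ; total = refl
  ; power-fits = inj₁
  ; centred-fits = λ t≤j → inj₁ (≤-trans t≤j j≤i , t≤j)
  ; framed-fits = λ t≤k → ≤-trans t≤k k≤i , t≤k }
... | inj₁ j≤i | inj₂ i≤k | _ | _ = record
  { powers = k ; centred = j ; framed = i ; total = solve 3 (λ i j k → k :+ j :+ i := i :+ j :+ k) refl i j k
  ; power-fits = λ t<k → inj₂ (inj₂ t<k)
  ; centred-fits = λ t≤j → inj₂ (t≤j , ≤-trans t≤j (≤-trans j≤i i≤k))
  ; framed-fits = λ t≤i → t≤i , ≤-trans t≤i i≤k }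
... | inj₂ i≤j | _ | inj₂ j≤k | _ = record
  { powers = k ; centred = j ; framed = i ; total = solve 3 (λ i j k → k :+ j :+ i := i :+ j :+ k) refl i j k
  ; power-fits = λ t<k → inj₂ (inj₂ t<k)
  ; centred-fits = λ t≤j → inj₂ (t≤j , ≤-trans t≤j j≤k)
  ; framed-fits = λ t≤i → t≤i , ≤-trans t≤i (≤-trans i≤j j≤k) }
... | inj₂ i≤j | _ | inj₁ k≤j | inj₁ i≤k = record
  { powers = j ; centred = k ; framed = i ; total = solve 3 (λ i j k → j :+ k :+ i := i :+ j :+ k) refl i j k
  ; power-fits = λ t<j → inj₂ (inj₁ t<j)
  ; centred-fits = λ t≤k → inj₂ (≤-trans t≤k k≤j , t≤k)
  ; framed-fits = λ t≤i → t≤i , ≤-trans t≤i i≤k }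
... | inj₂ i≤j | _ | inj₁ k≤j | inj₂ k≤i = record
  { powers = j ; centred = i ; framed = k ; total = solve 3 (λ i j k → j :+ i :+ k := i :+ j :+ k) refl i j k
  ; power-fits = λ t<j → inj₂ (inj₁ t<j)
  ; centred-fits = λ t≤i → inj₁ (t≤i , ≤-trans t≤i i≤j)
  ; framed-fits = λ t≤k → ≤-trans t≤k k≤i , t≤k }

replicate-injective : ∀ {m n} (c : Bool) → replicate m c ≡ replicate n c → m ≡ n
replicate-injective {m} {n} c eq = trans (sym (length-replicate m)) (trans (cong length eq) (length-replicate n))

replicate-not-injective : ∀ a m n {u v} → replicate m a ++ not a ∷ u ≡ replicate n a ++ not a ∷ v → m ≡ n
replicate-not-injective a zero zero eq = refl
replicate-not-injective a zero (suc n) eq = ⊥-elim (not-¬ refl (sym (∷-injectiveˡ eq)))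
replicate-not-injective a (suc m) zero eq = ⊥-elim (not-¬ refl (∷-injectiveˡ eq))
replicate-not-injective a (suc m) (suc n) eq = cong suc (replicate-not-injective a m n (∷-injectiveʳ eq))

NonEmpty-++-∷ : ∀ u (c : Bool) v → NonEmpty (u ++ c ∷ v)
NonEmpty-++-∷ [] c v = s≤s z≤n
NonEmpty-++-∷ (_ ∷ u) c v = s≤s z≤n

module TwoBPalindromes (a : Bool) (i j k : ℕ) where
  open TwoBCounts (twoBCounts i j k)

  b : Bool
  b = not a

  w : Word
  w = twoB a i j k

  power centredWord framedWord : ℕ → Word
  power t = replicate (suc t) a
  centredWord t = replicate t a ++ (b ∷ []) ++ replicate t a
  framedWord t = twoB a t j t

  Ps Cs Fs : List Word
  Ps = applyUpTo power powers
  Cs = applyUpTo centredWord (suc centred)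
  Fs = applyUpTo framedWord (suc framed)

  power-sound : ∀ {t} → t < powers → NonEmptyPalFactor w (power t)
  power-sound {t} t<powers = s≤s z≤n , replicate-palindrome (suc t) a , occurs (power-fits t<powers)
    where
    occurs : t < i ⊎ t < j ⊎ t < k → Factor (power t) w
    occurs (inj₁ t<i) = Factor-++ʳ _ (Factor-replicate a t<i)
    occurs (inj₂ (inj₁ t<j)) =
      Factor-++ˡ (replicate i a) (Factor-++ˡ (b ∷ []) (Factor-++ʳ (b ∷ replicate k a) (Factor-replicate a t<j)))
    occurs (inj₂ (inj₂ t<k)) =
      Factor-++ˡ (replicate i a) (Factor-++ˡ (b ∷ []) (Factor-++ˡ (replicate j a) (Factor-++ˡ (b ∷ []) (Factor-replicate a t<k))))

  centred-sound : ∀ {t} → t ≤ centred → NonEmptyPalFactor w (centredWord t)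
  centred-sound {t} t≤centred =
    NonEmpty-++-∷ (replicate t a) b _ , palindrome-mirror (replicate-palindrome t a) refl , occurs (centred-fits t≤centred)
    where
    occurs : (t ≤ i × t ≤ j) ⊎ (t ≤ j × t ≤ k) → Factor (centredWord t) w
    occurs (inj₁ (t≤i , t≤j)) = subst (Factor _) (++-assoc (replicate i a) (b ∷ replicate j a) (b ∷ replicate k a))
      (Factor-++ʳ (b ∷ replicate k a) (Factor-mirror a (b ∷ []) t≤i t≤j))
    occurs (inj₂ (t≤j , t≤k)) = Factor-++ˡ (replicate i a) (Factor-++ˡ (b ∷ []) (Factor-mirror a (b ∷ []) t≤j t≤k))

  framed-sound : ∀ {t} → t ≤ framed → NonEmptyPalFactor w (framedWord t)
  framed-sound {t} t≤framed with t≤i , t≤k ← framed-fits t≤framed =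
    NonEmpty-++-∷ (replicate t a) b _ ,
    subst Palindrome (sym (twoB-mirror a t j t))
      (palindrome-mirror (replicate-palindrome t a) (palindrome-mirror {b ∷ []} refl (replicate-palindrome j a))) ,
    subst₂ Factor (sym (twoB-mirror a t j t)) (sym (twoB-mirror a i j k)) (Factor-mirror a (b ∷ replicate j a ++ b ∷ []) t≤i t≤k)

  counted : ∀ (f : ℕ → Word) {m n v} → (∀ t → countOther a (f t) ≡ n) → v ∈ applyUpTo f m → countOther a v ≡ n
  counted f count v∈ with t , _ , refl ← ∈-applyUpTo⁻ f v∈ = count t

  power-count : ∀ t → countOther a (power t) ≡ 0
  power-count t = countOther-replicate a (suc t)

  centred-count : ∀ t → countOther a (centredWord t) ≡ 1
  centred-count t = trans (countOther-replicate-not a t (replicate t a)) (cong suc (countOther-replicate a t))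

  framed-count : ∀ t → countOther a (framedWord t) ≡ 2
  framed-count t = countOther-twoB a t j t

  palindromeList : List Word
  palindromeList = Ps ++ Cs ++ Fs

  palindromeList-unique : Unique palindromeList
  palindromeList-unique = ++⁺ Ps! (++⁺ Cs! Fs! Cs-Fs-disjoint) Ps-CsFs-disjoint
    where
    Ps! : Unique Ps
    Ps! = applyUpTo⁺₁ power powers λ t<u _ eq → <⇒≢ t<u (suc-injective (replicate-injective a eq))
    Cs! : Unique Cs
    Cs! = applyUpTo⁺₁ centredWord (suc centred) λ t<u _ eq → <⇒≢ t<u (replicate-not-injective a _ _ eq)
    Fs! : Unique Fs
    Fs! = applyUpTo⁺₁ framedWord (suc framed) λ t<u _ eq → <⇒≢ t<u (replicate-not-injective a _ _ eq)
    Cs-Fs-disjoint : ∀ {v} → ¬ (v ∈ Cs × v ∈ Fs)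
    Cs-Fs-disjoint (v∈Cs , v∈Fs) with () ← trans (sym (counted centredWord centred-count v∈Cs)) (counted framedWord framed-count v∈Fs)
    Ps-CsFs-disjoint : ∀ {v} → ¬ (v ∈ Ps × v ∈ Cs ++ Fs)
    Ps-CsFs-disjoint (v∈Ps , v∈CsFs) with ∈-++⁻ Cs v∈CsFs
    ... | inj₁ v∈Cs with () ← trans (sym (counted power power-count v∈Ps)) (counted centredWord centred-count v∈Cs)
    ... | inj₂ v∈Fs with () ← trans (sym (counted power power-count v∈Ps)) (counted framedWord framed-count v∈Fs)

  palindromeList-sound : ∀ {v} → v ∈ palindromeList → NonEmptyPalFactor w v
  palindromeList-sound v∈ with ∈-++⁻ Ps v∈
  ... | inj₁ v∈Ps with t , t< , refl ← ∈-applyUpTo⁻ power v∈Ps = power-sound t<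
  ... | inj₂ v∈CsFs with ∈-++⁻ Cs v∈CsFs
  ...   | inj₁ v∈Cs with t , s≤s t≤ , refl ← ∈-applyUpTo⁻ centredWord v∈Cs = centred-sound t≤
  ...   | inj₂ v∈Fs with t , s≤s t≤ , refl ← ∈-applyUpTo⁻ framedWord v∈Fs = framed-sound t≤

  palindromeList-length : length palindromeList ≡ length w
  palindromeList-length = begin
    length (Ps ++ Cs ++ Fs)                      ≡⟨ length-++ Ps ⟩
    length Ps + length (Cs ++ Fs)                ≡⟨ cong (length Ps +_) (length-++ Cs) ⟩
    length Ps + (length Cs + length Fs)          ≡⟨ cong₂ _+_ (length-applyUpTo power powers)
                                                      (cong₂ _+_ (length-applyUpTo centredWord (suc centred)) (length-applyUpTo framedWord (suc framed))) ⟩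
    powers + (suc centred + suc framed)          ≡⟨ two-more powers centred framed ⟩
    2 + (powers + centred + framed)              ≡⟨ cong (2 +_) total ⟩
    2 + (i + j + k)                              ≡⟨ solve 3 (λ i j k → con 2 :+ (i :+ j :+ k) := i :+ (con 1 :+ (j :+ (con 1 :+ k)))) refl i j k ⟩
    i + suc (j + suc k)                          ≡⟨ length-twoB a i j k ⟨
    length w                                     ∎
    where
    open ≡-Reasoning
    two-more : ∀ p c f → p + (suc c + suc f) ≡ 2 + (p + c + f)
    two-more = solve 3 (λ p c f → p :+ (con 1 :+ c :+ (con 1 :+ f)) := con 2 :+ (p :+ c :+ f)) refl

twoB-rich : ∀ a i j k → Rich (twoB a i j k)
twoB-rich a i j k = Rich-byPalindromes (twoB a i j k) palindromeList-unique palindromeList-sound palindromeList-length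
  where open TwoBPalindromes a i j k

countOther-InBR : ∀ a {w v} → InBR w v → countOther a v ≡ countOther a w
countOther-InBR a (Bs , _ , _ , refl , refl) = countOther-concat-reverse a Bs

twoB-BRRich : ∀ a i j k → BRRich (twoB a i j k)
twoB-BRRich a i j k v v∈BR
  with i′ , j′ , k′ , refl ← countOther≡2 a v (trans (countOther-InBR a v∈BR) (countOther-twoB a i j k))
  = twoB-rich a i′ j′ k′

-- Five-run words

alternating-suc : ∀ x y n ns → x ∷ alternating x y (n ∷ ns) ≡ alternating x y (suc n ∷ ns)
alternating-suc x y n [] = refl
alternating-suc x y n (_ ∷ _) = refl

runDecomposition : ∀ c u → ∃[ ns ] (length ns ≡ l (c ∷ u) × c ∷ u ≡ alternating c (not c) (map suc ns))
runDecomposition c [] = 0 ∷ [] , refl , refl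
runDecomposition c (d ∷ u) with runDecomposition d u
... | [] , _ , ()
... | n ∷ ns , len , eq with c | d
...   | true | true = suc n ∷ ns , len , trans (cong (true ∷_) eq) (alternating-suc true false (suc n) (map suc ns))
...   | false | false = suc n ∷ ns , len , trans (cong (false ∷_) eq) (alternating-suc false true (suc n) (map suc ns))
...   | true | false = 0 ∷ n ∷ ns , cong suc len , cong (true ∷_) eq
...   | false | true = 0 ∷ n ∷ ns , cong suc len , cong (false ∷_) eq

fiveRuns : Bool → ℕ → ℕ → ℕ → ℕ → ℕ → Word
fiveRuns a i₁ i₂ i₃ i₄ i₅ = alternating a (not a) (map suc (i₁ ∷ i₂ ∷ i₃ ∷ i₄ ∷ i₅ ∷ []))

length≡5 : ∀ (ns : List ℕ) → length ns ≡ 5 → ∃[ i₁ ] ∃[ i₂ ] ∃[ i₃ ] ∃[ i₄ ] ∃[ i₅ ] (ns ≡ i₁ ∷ i₂ ∷ i₃ ∷ i₄ ∷ i₅ ∷ [])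
length≡5 (i₁ ∷ i₂ ∷ i₃ ∷ i₄ ∷ i₅ ∷ []) _ = i₁ , i₂ , i₃ , i₄ , i₅ , refl
length≡5 [] ()
length≡5 (_ ∷ []) ()
length≡5 (_ ∷ _ ∷ []) ()
length≡5 (_ ∷ _ ∷ _ ∷ []) ()
length≡5 (_ ∷ _ ∷ _ ∷ _ ∷ []) ()
length≡5 (_ ∷ _ ∷ _ ∷ _ ∷ _ ∷ _ ∷ _) ()

fiveRuns-structure : ∀ w → l w ≡ 5 → ∃[ a ] ∃[ i₁ ] ∃[ i₂ ] ∃[ i₃ ] ∃[ i₄ ] ∃[ i₅ ] (w ≡ fiveRuns a i₁ i₂ i₃ i₄ i₅)
fiveRuns-structure (c ∷ u) l≡5 with ns , len , eq ← runDecomposition c u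
  with i₁ , i₂ , i₃ , i₄ , i₅ , refl ← length≡5 ns (trans len l≡5) = c , i₁ , i₂ , i₃ , i₄ , i₅ , eq

BRRich-shortForm : ∀ r₁ r₃ r₅ →
  let check = λ c n₂ n₄ → True (all? rich? (brList (alternating c (not c) (r₁ ∷ n₂ ∷ r₃ ∷ n₄ ∷ r₅ ∷ [])))) in
  check true 1 3 → check true 2 2 → check true 3 1 → check false 1 3 → check false 2 2 → check false 3 1 →
  ∀ a {n₂ n₄} → 1 ≤ n₂ → 1 ≤ n₄ → n₂ + n₄ ≡ 4 → BRRich (alternating a (not a) (r₁ ∷ n₂ ∷ r₃ ∷ n₄ ∷ r₅ ∷ []))
BRRich-shortForm _ _ _ ok _ _ _ _ _ true {1} _ _ refl = BRRich-byComputation _ ok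
BRRich-shortForm _ _ _ _ ok _ _ _ _ true {2} _ _ refl = BRRich-byComputation _ ok
BRRich-shortForm _ _ _ _ _ ok _ _ _ true {3} _ _ refl = BRRich-byComputation _ ok
BRRich-shortForm _ _ _ _ _ _ ok _ _ false {1} _ _ refl = BRRich-byComputation _ ok
BRRich-shortForm _ _ _ _ _ _ _ ok _ false {2} _ _ refl = BRRich-byComputation _ ok
BRRich-shortForm _ _ _ _ _ _ _ _ ok false {3} _ _ refl = BRRich-byComputation _ ok
BRRich-shortForm _ _ _ _ _ _ _ _ _ _ {suc (suc (suc (suc n₂)))} _ (s≤s _) sum = ⊥-elim (m+1+n≢0 n₂ (cong (_∸ 4) sum))

Form⇒BRRich : ∀ a w → Form a w → BRRich w
Form⇒BRRich a w (inj₁ (n₁ , n₃ , n₅ , _ , _ , _ , refl)) = twoB-BRRich a n₁ n₃ n₅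
Form⇒BRRich a w (inj₂ (inj₁ (_ , _ , 1≤n₂ , 1≤n₄ , sum , refl))) =
  BRRich-shortForm 1 1 2 tt tt tt tt tt tt a 1≤n₂ 1≤n₄ sum
Form⇒BRRich a w (inj₂ (inj₂ (inj₁ (_ , _ , 1≤n₂ , 1≤n₄ , sum , refl)))) =
  BRRich-shortForm 2 1 1 tt tt tt tt tt tt a 1≤n₂ 1≤n₄ sum
Form⇒BRRich a w (inj₂ (inj₂ (inj₂ (_ , _ , 1≤n₂ , 1≤n₄ , sum , refl)))) =
  BRRich-shortForm 1 2 1 tt tt tt tt tt tt a 1≤n₂ 1≤n₄ sum

tooShort : ∀ {n} → True (n ≤? 7) → ¬ 7 < n
tooShort ok = ≤⇒≯ (toWitness ok)

-- In the refuted cases the block sizes count pieces (letters and pads), not letters, and the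
-- last block is what remains.
BRRich⇒Form : ∀ a i₁ i₂ i₃ i₄ i₅ → 7 < length (fiveRuns a i₁ i₂ i₃ i₄ i₅) →
  BRRich (fiveRuns a i₁ i₂ i₃ i₄ i₅) → ∃[ a′ ] Form a′ (fiveRuns a i₁ i₂ i₃ i₄ i₅)
BRRich⇒Form a e₁ 0 e₃ 0 e₅ _ _ = a , inj₁ (suc e₁ , suc e₃ , suc e₅ , s≤s z≤n , s≤s z≤n , s≤s z≤n , refl)
BRRich⇒Form a 0 0 0 1 0 long _ = ⊥-elim (tooShort tt long)
BRRich⇒Form a 0 0 0 1 1 long _ = ⊥-elim (tooShort tt long)
BRRich⇒Form a 0 0 0 1 (suc (suc e₅)) _ brRich = ⊥-elim (¬BRRich-byComputation a
  (exactly 1 ∷ exactly 1 ∷ exactly 1 ∷ exactly 2 ∷ padded 1 e₅ 2 ∷ []) (1 ∷ 5 ∷ []) tt tt (s≤s z≤n) brRich)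
BRRich⇒Form a 0 0 0 2 0 long _ = ⊥-elim (tooShort tt long)
BRRich⇒Form a 0 0 0 2 1 _ _ = a , inj₂ (inj₁ (1 , 3 , s≤s z≤n , s≤s z≤n , refl , refl))
BRRich⇒Form a 0 0 0 2 (suc (suc e₅)) _ brRich = ⊥-elim (¬BRRich-byComputation a
  (exactly 1 ∷ exactly 1 ∷ exactly 1 ∷ exactly 3 ∷ padded 1 e₅ 2 ∷ []) (1 ∷ 6 ∷ []) tt tt (s≤s z≤n) brRich)
BRRich⇒Form a 0 0 0 (suc (suc (suc e₄))) e₅ _ brRich = ⊥-elim (¬BRRich-byComputation a
  (exactly 1 ∷ exactly 1 ∷ exactly 1 ∷ padded 2 e₄ 2 ∷ padded 1 e₅ 0 ∷ []) (5 ∷ 4 ∷ []) tt tt (s≤s z≤n) brRich)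
BRRich⇒Form a 1 0 0 1 0 long _ = ⊥-elim (tooShort tt long)
BRRich⇒Form a 1 0 0 2 0 _ _ = a , inj₂ (inj₂ (inj₁ (1 , 3 , s≤s z≤n , s≤s z≤n , refl , refl)))
BRRich⇒Form a 1 0 0 (suc (suc (suc e₄))) 0 _ brRich = ⊥-elim (¬BRRich-byComputation a
  (exactly 2 ∷ exactly 1 ∷ exactly 1 ∷ padded 2 e₄ 2 ∷ exactly 1 ∷ []) (6 ∷ []) tt tt (s≤s z≤n) brRich)
BRRich⇒Form a 1 0 0 (suc e₄) (suc e₅) _ brRich = ⊥-elim (¬BRRich-byComputation a
  (exactly 2 ∷ exactly 1 ∷ exactly 1 ∷ padded 2 e₄ 0 ∷ padded 0 e₅ 2 ∷ []) (2 ∷ 4 ∷ []) tt tt (s≤s z≤n) brRich)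
BRRich⇒Form a (suc (suc e₁)) 0 0 (suc e₄) e₅ _ brRich = ⊥-elim (¬BRRich-byComputation a
  (padded 0 e₁ 3 ∷ exactly 1 ∷ exactly 1 ∷ padded 2 e₄ 0 ∷ padded 0 e₅ 1 ∷ []) (1 ∷ 2 ∷ 5 ∷ []) tt tt (s≤s z≤n) brRich)
BRRich⇒Form a 0 0 1 1 0 long _ = ⊥-elim (tooShort tt long)
BRRich⇒Form a 0 0 1 2 0 _ _ = a , inj₂ (inj₂ (inj₂ (1 , 3 , s≤s z≤n , s≤s z≤n , refl , refl)))
BRRich⇒Form a 0 0 1 (suc (suc (suc e₄))) 0 _ brRich = ⊥-elim (¬BRRich-byComputation a
  (exactly 1 ∷ exactly 1 ∷ exactly 2 ∷ padded 2 e₄ 2 ∷ exactly 1 ∷ []) (1 ∷ 5 ∷ []) tt tt (s≤s z≤n) brRich)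
BRRich⇒Form a 0 0 1 (suc e₄) (suc e₅) _ brRich = ⊥-elim (¬BRRich-byComputation a
  (exactly 1 ∷ exactly 1 ∷ exactly 2 ∷ padded 2 e₄ 0 ∷ padded 0 e₅ 2 ∷ []) (4 ∷ 2 ∷ []) tt tt (s≤s z≤n) brRich)
BRRich⇒Form a (suc e₁) 0 1 (suc e₄) e₅ _ brRich = ⊥-elim (¬BRRich-byComputation a
  (padded 0 e₁ 2 ∷ exactly 1 ∷ exactly 2 ∷ padded 2 e₄ 0 ∷ padded 0 e₅ 1 ∷ []) (1 ∷ 1 ∷ 3 ∷ 3 ∷ []) tt tt (s≤s z≤n) brRich)
BRRich⇒Form a e₁ 0 (suc (suc e₃)) (suc e₄) e₅ _ brRich = ⊥-elim (¬BRRich-byComputation a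
  (padded 0 e₁ 1 ∷ exactly 1 ∷ padded 2 e₃ 1 ∷ padded 2 e₄ 0 ∷ padded 0 e₅ 1 ∷ []) (1 ∷ 5 ∷ 3 ∷ []) tt tt (s≤s z≤n) brRich)
BRRich⇒Form a 0 1 0 0 0 long _ = ⊥-elim (tooShort tt long)
BRRich⇒Form a 0 1 0 0 1 long _ = ⊥-elim (tooShort tt long)
BRRich⇒Form a 0 1 0 0 (suc (suc e₅)) _ brRich = ⊥-elim (¬BRRich-byComputation a
  (exactly 1 ∷ exactly 2 ∷ exactly 1 ∷ exactly 1 ∷ padded 1 e₅ 2 ∷ []) (1 ∷ 5 ∷ []) tt tt (s≤s z≤n) brRich)
BRRich⇒Form a 0 1 0 1 0 long _ = ⊥-elim (tooShort tt long)
BRRich⇒Form a 0 1 0 1 1 _ _ = a , inj₂ (inj₁ (2 , 2 , s≤s z≤n , s≤s z≤n , refl , refl))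
BRRich⇒Form a 0 1 0 1 (suc (suc e₅)) _ brRich = ⊥-elim (¬BRRich-byComputation a
  (exactly 1 ∷ exactly 2 ∷ exactly 1 ∷ exactly 2 ∷ padded 1 e₅ 2 ∷ []) (2 ∷ 5 ∷ []) tt tt (s≤s z≤n) brRich)
BRRich⇒Form a 0 1 0 (suc (suc e₄)) e₅ _ brRich = ⊥-elim (¬BRRich-byComputation a
  (exactly 1 ∷ exactly 2 ∷ exactly 1 ∷ padded 1 e₄ 2 ∷ padded 1 e₅ 0 ∷ []) (3 ∷ 2 ∷ 4 ∷ []) tt tt (s≤s z≤n) brRich)
BRRich⇒Form a 1 1 0 0 0 long _ = ⊥-elim (tooShort tt long)
BRRich⇒Form a 1 1 0 1 0 _ _ = a , inj₂ (inj₂ (inj₁ (2 , 2 , s≤s z≤n , s≤s z≤n , refl , refl)))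
BRRich⇒Form a 1 1 0 (suc (suc e₄)) 0 _ brRich = ⊥-elim (¬BRRich-byComputation a
  (exactly 2 ∷ exactly 2 ∷ exactly 1 ∷ padded 1 e₄ 2 ∷ exactly 1 ∷ []) (5 ∷ 1 ∷ []) tt tt (s≤s z≤n) brRich)
BRRich⇒Form a 1 1 0 e₄ (suc e₅) _ brRich = ⊥-elim (¬BRRich-byComputation a
  (exactly 2 ∷ exactly 2 ∷ exactly 1 ∷ padded 1 e₄ 0 ∷ padded 0 e₅ 2 ∷ []) (2 ∷ 4 ∷ []) tt tt (s≤s z≤n) brRich)
BRRich⇒Form a (suc (suc e₁)) 1 0 e₄ e₅ _ brRich = ⊥-elim (¬BRRich-byComputation a
  (padded 0 e₁ 3 ∷ exactly 2 ∷ exactly 1 ∷ padded 1 e₄ 0 ∷ padded 0 e₅ 1 ∷ []) (1 ∷ 2 ∷ 5 ∷ []) tt tt (s≤s z≤n) brRich)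
BRRich⇒Form a 0 2 0 0 0 long _ = ⊥-elim (tooShort tt long)
BRRich⇒Form a 0 2 0 0 1 _ _ = a , inj₂ (inj₁ (3 , 1 , s≤s z≤n , s≤s z≤n , refl , refl))
BRRich⇒Form a 0 2 0 0 (suc (suc e₅)) _ brRich = ⊥-elim (¬BRRich-byComputation a
  (exactly 1 ∷ exactly 3 ∷ exactly 1 ∷ exactly 1 ∷ padded 1 e₅ 2 ∷ []) (1 ∷ 6 ∷ []) tt tt (s≤s z≤n) brRich)
BRRich⇒Form a 1 2 0 0 0 _ _ = a , inj₂ (inj₂ (inj₁ (3 , 1 , s≤s z≤n , s≤s z≤n , refl , refl)))
BRRich⇒Form a 1 2 0 0 (suc e₅) _ brRich = ⊥-elim (¬BRRich-byComputation a
  (exactly 2 ∷ exactly 3 ∷ exactly 1 ∷ exactly 1 ∷ padded 0 e₅ 2 ∷ []) (2 ∷ 5 ∷ []) tt tt (s≤s z≤n) brRich)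
BRRich⇒Form a (suc (suc e₁)) 2 0 0 e₅ _ brRich = ⊥-elim (¬BRRich-byComputation a
  (padded 0 e₁ 3 ∷ exactly 3 ∷ exactly 1 ∷ exactly 1 ∷ padded 0 e₅ 1 ∷ []) (1 ∷ 2 ∷ 6 ∷ []) tt tt (s≤s z≤n) brRich)
BRRich⇒Form a e₁ (suc (suc (suc e₂))) 0 0 e₅ _ brRich = ⊥-elim (¬BRRich-byComputation a
  (padded 0 e₁ 1 ∷ padded 2 e₂ 2 ∷ exactly 1 ∷ exactly 1 ∷ padded 1 e₅ 0 ∷ []) (1 ∷ 3 ∷ 6 ∷ []) tt tt (s≤s z≤n) brRich)
BRRich⇒Form a e₁ (suc (suc e₂)) 0 (suc e₄) e₅ _ brRich = ⊥-elim (¬BRRich-byComputation a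
  (padded 0 e₁ 1 ∷ padded 2 e₂ 1 ∷ exactly 1 ∷ padded 0 e₄ 2 ∷ padded 1 e₅ 0 ∷ []) (1 ∷ 4 ∷ 2 ∷ 4 ∷ []) tt tt (s≤s z≤n) brRich)
BRRich⇒Form a 0 1 1 0 0 long _ = ⊥-elim (tooShort tt long)
BRRich⇒Form a 0 1 1 1 0 _ _ = a , inj₂ (inj₂ (inj₂ (2 , 2 , s≤s z≤n , s≤s z≤n , refl , refl)))
BRRich⇒Form a 0 1 1 (suc (suc e₄)) 0 _ brRich = ⊥-elim (¬BRRich-byComputation a
  (exactly 1 ∷ exactly 2 ∷ exactly 2 ∷ padded 1 e₄ 2 ∷ exactly 1 ∷ []) (3 ∷ 3 ∷ []) tt tt (s≤s z≤n) brRich)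
BRRich⇒Form a 0 2 1 0 0 _ _ = a , inj₂ (inj₂ (inj₂ (3 , 1 , s≤s z≤n , s≤s z≤n , refl , refl)))
BRRich⇒Form a 0 2 1 (suc e₄) 0 _ brRich = ⊥-elim (¬BRRich-byComputation a
  (exactly 1 ∷ exactly 3 ∷ exactly 2 ∷ padded 0 e₄ 2 ∷ exactly 1 ∷ []) (3 ∷ 2 ∷ []) tt tt (s≤s z≤n) brRich)
BRRich⇒Form a 0 (suc (suc (suc e₂))) 1 e₄ 0 _ brRich = ⊥-elim (¬BRRich-byComputation a
  (exactly 1 ∷ padded 2 e₂ 2 ∷ exactly 2 ∷ padded 1 e₄ 0 ∷ exactly 1 ∷ []) (3 ∷ 6 ∷ []) tt tt (s≤s z≤n) brRich)
BRRich⇒Form a 0 (suc e₂) 1 e₄ (suc e₅) _ brRich = ⊥-elim (¬BRRich-byComputation a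
  (exactly 1 ∷ padded 0 e₂ 2 ∷ exactly 2 ∷ padded 1 e₄ 0 ∷ padded 0 e₅ 2 ∷ []) (2 ∷ 3 ∷ 1 ∷ 1 ∷ []) tt tt (s≤s z≤n) brRich)
BRRich⇒Form a (suc e₁) (suc e₂) 1 e₄ e₅ _ brRich = ⊥-elim (¬BRRich-byComputation a
  (padded 0 e₁ 2 ∷ padded 0 e₂ 2 ∷ exactly 2 ∷ padded 1 e₄ 0 ∷ padded 0 e₅ 1 ∷ []) (1 ∷ 3 ∷ 1 ∷ 2 ∷ 2 ∷ []) tt tt (s≤s z≤n) brRich)
BRRich⇒Form a e₁ (suc e₂) 2 e₄ e₅ _ brRich = ⊥-elim (¬BRRich-byComputation a
  (padded 0 e₁ 1 ∷ padded 0 e₂ 2 ∷ exactly 3 ∷ padded 1 e₄ 0 ∷ padded 0 e₅ 1 ∷ []) (1 ∷ 2 ∷ 3 ∷ 1 ∷ 2 ∷ []) tt tt (s≤s z≤n) brRich)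
BRRich⇒Form a e₁ (suc e₂) (suc (suc (suc e₃))) e₄ e₅ _ brRich = ⊥-elim (¬BRRich-byComputation a
  (padded 0 e₁ 1 ∷ padded 0 e₂ 2 ∷ padded 2 e₃ 2 ∷ padded 1 e₄ 0 ∷ padded 0 e₅ 1 ∷ []) (3 ∷ 5 ∷ 1 ∷ 2 ∷ []) tt tt (s≤s z≤n) brRich)

proposition4p17 : (w : Word) → BinaryWord w → 7 < length w → l w ≡ 5 →
    ((∀ v → InBR w v → Rich v) ⇔ (∃[ a ] Form a w))
proposition4p17 w _ long l≡5 with a , i₁ , i₂ , i₃ , i₄ , i₅ , refl ← fiveRuns-structure w l≡5 =
  mk⇔ (BRRich⇒Form a i₁ i₂ i₃ i₄ i₅ long) (λ (a′ , form) → Form⇒BRRich a′ _ form)
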